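{- Let $\Gamma$ be a finite set of genes, $\Sigma$ a finite set of species, $\sigma:\Gamma\to\Sigma$ a map, $N$ a species network whose leaves include $\sigma(\Gamma)$, $R=(\Gamma,E)$ a relation graph, and $k\ge 0$ an integer. Then $R$ is $N$-consistent using $k$ transfers if and only if there exists a least-resolved DS-tree $D$ on $\Gamma$ with $R(D)=R$ and there exists a binary refinement $D'$ of $D$ such that $D'$ is $N$-reconcilable using $k$ transfers. (The same equivalence holds with "using $k$ transfers" omitted on both sides.)
   Context: A species network $N$ is a rooted directed acyclic graph whose arcs are partitioned into principal arcs $E_p(N)$ and secondary (transfer) arcs $E_s(N)$, such that $(V(N),E_p(N))$ is a rooted tree $T_0(N)$ (the distinguished base tree) spanning all nodes, whose leaves are species; endpoints of secondary arcs are nodes having one parent and one child in $T_0(N)$; and $N$ is time-consistent: there is $t:V(N)\to\mathbb{Z}$ with $t(u)<t(v)$ for each principal arc $(u,v)$ and $t(u)=t(v)$ for each secondary arc $(u,v)$. Ancestor/descendant/incomparability refer to $T_0(N)$. A gene tree is a rooted binary tree $G$ with leaf set $\Gamma$. A reconciliation of $G$ with $N$ assigns to each $u\in V(G)$ a nonempty sequence $\alpha(u)=(\alpha_1(u),\dots,\alpha_\ell(u))$ of nodes of $N$ (write $\alpha_{\mathrm{last}}(u)=\alpha_\ell(u)$) and an event $e(u,i)$ to each position, such that: for $i<\ell$, $(\alpha_i(u),\alpha_{i+1}(u))$ is an arc of $N$ and $e(u,i)=\mathrm{SL}$ if it is a principal arc out of a node with two children in $T_0(N)$, $e(u,i)=\emptyset$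 if it is a principal arc out of a node with one child in $T_0(N)$, and $e(u,i)=\mathrm{TL}$ if it is a secondary arc; if $u$ is a leaf then $\alpha_{\mathrm{last}}(u)=\sigma(u)$ and $e(u,\ell)$ = extant; if $u$ is internal with children $u',u''$ then $e(u,\ell)=\mathrm{S}$ when $\alpha_1(u'),\alpha_1(u'')$ are the two distinct children of $\alpha_{\mathrm{last}}(u)$ in $T_0(N)$, $e(u,\ell)=\mathrm{D}$ when $\alpha_1(u')=\alpha_1(u'')=\alpha_{\mathrm{last}}(u)$, and $e(u,\ell)=\mathrm{T}$ when one of $(\alpha_{\mathrm{last}}(u),\alpha_1(u'))$, $(\alpha_{\mathrm{last}}(u),\alpha_1(u''))$ is a secondary arc and the other is a principal arc; one of these cases must hold. The number of transfers of $\alpha$ is the number of pairs $(u,i)$ with $e(u,i)\in\{\mathrm{T},\mathrm{TL}\}$. A relation graph is a graph $R=(\Gamma,E)$. $G$ with reconciliation $\alpha$ displays $R$ if there is a relabelling $e^*$ with $e^*(u,i)\in\{\mathrm{TS},\mathrm{TD}\}$ when $e(u,i)=\mathrm{T}$ and $e^*(u,i)=e(u,i)$ otherwise, such that for all distinct $x,y\in\Gamma$: $xy\in E$ iff $e^*$ at the last position of $\mathrm{lca}_G(x,y)$ lies in $\{\mathrm{S},\mathrm{TS}\}$ (and otherwise it lies in $\{\mathrm{D},\mathrm{TD}\}$). $R$ is $N$-consistent using $k$ transfers if some gene tree $G$ on $\Gamma$ has a reconciliation with $N$ using $k$ transfers that displays $R$. A DS-tree is a rooted tree $D$ with leaf set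 $\Gamma$ whose internal nodes $u$ carry labels $l(u)\in\{\mathrm{S},\mathrm{D}\}$; $R(D)$ is the graph on $\Gamma$ with $xy$ an edge iff $l(\mathrm{lca}_D(x,y))=\mathrm{S}$. $D$ is least-resolved if no arc joins two internal nodes with the same label. A binary refinement of $D$ is a binary DS-tree $D'$ from which $D$ is obtained by contracting arcs between internal nodes of equal label (keeping labels). A binary DS-tree $D'$ is $N$-reconcilable using $k$ transfers if there is a reconciliation $\alpha$ of $D'$ (as gene tree) with $N$ using $k$ transfers such that for every internal $u$, $l(u)=\mathrm{S}$ implies $e(u,\mathrm{last})\in\{\mathrm{S},\mathrm{T}\}$ and $l(u)=\mathrm{D}$ implies $e(u,\mathrm{last})\in\{\mathrm{D},\mathrm{T}\}$. -}

module Defs where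

open import Data.Nat using (ℕ; zero; suc; _+_; _≤_)
open import Data.Integer as ℤ using (ℤ)
open import Data.Fin using (Fin; _≟_)
open import Data.Maybe using (Maybe; just; nothing)
open import Data.Maybe.Properties using (≡-dec)
open import Data.List using (List; []; _∷_; _++_; length; filter; lookup; allFin)
open import Data.List.Membership.Propositional using (_∈_)
open import Data.List.Relation.Unary.All using (All)
open import Data.List.Relation.Binary.Permutation.Propositional using (_↭_)
open import Data.Product using (Σ; ∃; _×_; _,_; proj₁; proj₂)
open import Data.Sum using (_⊎_)
open import Data.Unit using (⊤)
open import Data.Bool using (Bool; true; false)
open import Relation.Binary.PropositionalEquality using (_≡_; _≢_)
open import Relation.Nullary using (¬_)
open import Relation.Binary.Construct.Closure.Transitive using (TransClosure)
open import Function.Bundles using (_⇔_)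

-- The distinguished base tree T₀(N) is given by a
-- parent function `par` (principal arcs are exactly the pairs
-- (p , v) with par v ≡ just p); `root` is the unique node without a
-- parent.  Secondary (transfer) arcs form the relation `Sec`.

children : ∀ {n} → (Fin n → Maybe (Fin n)) → Fin n → List (Fin n)
children {n} par u = filter (λ v → ≡-dec _≟_ (par v) (just u)) (allFin n)

OneParentOneChild : ∀ {n} → (Fin n → Maybe (Fin n)) → Fin n → Set
OneParentOneChild par u = (∃ λ p → par u ≡ just p) × length (children par u) ≡ 1

Arc : ∀ {n} → (Fin n → Maybe (Fin n)) → (Fin n → Fin n → Set) → Fin n → Fin n → Set
Arc par Sec u v = par v ≡ just u ⊎ Sec u v

record Network : Set₁ where
  field
    n          : ℕ
    par        : Fin n → Maybe (Fin n)
    root       : Fin n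
    root-par   : par root ≡ nothing
    nonroot    : ∀ u → u ≢ root → ∃ λ p → par u ≡ just p
    Sec        : Fin n → Fin n → Set
    disjoint   : ∀ {u v} → Sec u v → par v ≢ just u
    sec-tail   : ∀ {u v} → Sec u v → OneParentOneChild par u
    sec-head   : ∀ {u v} → Sec u v → OneParentOneChild par v
    acyclic    : ∀ u → ¬ TransClosure (Arc par Sec) u u
    time       : Fin n → ℤ
    time-prin  : ∀ {u v} → par v ≡ just u → time u ℤ.< time v
    time-sec   : ∀ {u v} → Sec u v → time u ≡ time v

nodes : Network → ℕ
nodes = Network.n

IsLeaf : (N : Network) → Fin (nodes N) → Set
IsLeaf N u = children (Network.par N) u ≡ []

data GTree (m : ℕ) : Set where
  leaf : Fin m → GTree m
  node : GTree m → GTree m → GTree m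

gleaves : ∀ {m} → GTree m → List (Fin m)
gleaves (leaf x)   = x ∷ []
gleaves (node g h) = gleaves g ++ gleaves h

GeneTreeOn : ∀ {m} → GTree m → Set
GeneTreeOn {m} G = gleaves G ↭ allFin m

data Label : Set where
  S D : Label

data DSTree (m : ℕ) : Set where
  leaf : Fin m → DSTree m
  node : Label → List (DSTree m) → DSTree m

mutual
  dleaves : ∀ {m} → DSTree m → List (Fin m)
  dleaves (leaf x)    = x ∷ []
  dleaves (node l ts) = dleavesL ts

  dleavesL : ∀ {m} → List (DSTree m) → List (Fin m)
  dleavesL []       = []
  dleavesL (t ∷ ts) = dleaves t ++ dleavesL ts

data WF {m} : DSTree m → Set where
  leafWF : ∀ {x} → WF (leaf x)
  nodeWF : ∀ {l ts} → 2 ≤ length ts → All WF ts → WF (node l ts)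

DSTreeOn : ∀ {m} → DSTree m → Set
DSTreeOn {m} T = WF T × dleaves T ↭ allFin m

labelOf : ∀ {m} → DSTree m → Maybe Label
labelOf (leaf x)    = nothing
labelOf (node l ts) = just l

data LeastResolved {m} : DSTree m → Set where
  leafLR : ∀ {x} → LeastResolved (leaf x)
  nodeLR : ∀ {l ts} → All (λ t → labelOf t ≢ just l) ts → All LeastResolved ts
         → LeastResolved (node l ts)

-- LcaLab T x y l : the lowest common ancestor of leaves x and y in T has label l
data LcaLab {m} : DSTree m → Fin m → Fin m → Label → Set where
  here  : ∀ {l ts x y} (i j : Fin (length ts)) → i ≢ j
        → x ∈ dleaves (lookup ts i) → y ∈ dleaves (lookup ts j)
        → LcaLab (node l ts) x y l
  there : ∀ {l l′ ts t x y} → t ∈ ts → LcaLab t x y l′ → LcaLab (node l ts) x y l′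

GraphIs : ∀ {m} → DSTree m → (Fin m → Fin m → Bool) → Set
GraphIs {m} T E = ∀ (x y : Fin m) → x ≢ y → (E x y ≡ true ⇔ LcaLab T x y S)

data BDS (m : ℕ) : Set where
  leaf : Fin m → BDS m
  node : Label → BDS m → BDS m → BDS m

toDS : ∀ {m} → BDS m → DSTree m
toDS (leaf x)       = leaf x
toDS (node l g h)   = node l (toDS g ∷ toDS h ∷ [])

shape : ∀ {m} → BDS m → GTree m
shape (leaf x)     = leaf x
shape (node l g h) = node (shape g) (shape h)

-- Contract T U : U is obtained from T by contracting some arcs joining
-- two internal nodes with equal label (labels kept).
mutual
  data Contract {m} : DSTree m → DSTree m → Set where
    leafC : ∀ {x} → Contract (leaf x) (leaf x)
    nodeC : ∀ {l ts us} → ContractL l ts us → Contract (node l ts) (node l us)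

  data ContractL {m} (l : Label) : List (DSTree m) → List (DSTree m) → Set where
    nilC  : ContractL l [] []
    keep  : ∀ {t u ts us} → Contract t u → ContractL l ts us → ContractL l (t ∷ ts) (u ∷ us)
    merge : ∀ {vs ws ts us} → ContractL l vs ws → ContractL l ts us
          → ContractL l (node l vs ∷ ts) (ws ++ us)

BinaryRefinement : ∀ {m} → BDS m → DSTree m → Set
BinaryRefinement D′ T = Contract (toDS D′) T

module _ (N : Network) where
  open Network N

  -- Seq a c : a sequence of nodes α₁ = a , … , α_ℓ = c with the events of
  -- the non-final positions (SL, ∅, TL)
  data Seq : Fin n → Fin n → Set where
    stop : ∀ {a} → Seq a a
    sl   : ∀ {a b c} → par b ≡ just a → length (children par a) ≡ 2 → Seq b c → Seq a c
    nl   : ∀ {a b c} → par b ≡ just a → length (children par a) ≡ 1 → Seq b c → Seq a c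
    tl   : ∀ {a b c} → Sec a b → Seq b c → Seq a c

  seqTransfers : ∀ {a c} → Seq a c → ℕ
  seqTransfers stop         = 0
  seqTransfers (sl _ _ s)   = seqTransfers s
  seqTransfers (nl _ _ s)   = seqTransfers s
  seqTransfers (tl _ s)     = suc (seqTransfers s)

  -- event at the last position of an internal node u, with
  -- α_last(u) = c, α₁(u′) = b₁, α₁(u″) = b₂
  data LastEv (c b₁ b₂ : Fin n) : Set where
    evS  : length (children par c) ≡ 2 → par b₁ ≡ just c → par b₂ ≡ just c → b₁ ≢ b₂
         → LastEv c b₁ b₂
    evD  : b₁ ≡ c → b₂ ≡ c → LastEv c b₁ b₂
    evT₁ : Sec c b₁ → par b₂ ≡ just c → LastEv c b₁ b₂
    evT₂ : par b₁ ≡ just c → Sec c b₂ → LastEv c b₁ b₂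

  lastTransfers : ∀ {c b₁ b₂} → LastEv c b₁ b₂ → ℕ
  lastTransfers (evS _ _ _ _) = 0
  lastTransfers (evD _ _)     = 0
  lastTransfers (evT₁ _ _)    = 1
  lastTransfers (evT₂ _ _)    = 1

  -- admissible S/D label (after relabelling T as TS or TD) for a last event
  LabelOK : ∀ {c b₁ b₂} → LastEv c b₁ b₂ → Label → Set
  LabelOK (evS _ _ _ _) l = l ≡ S
  LabelOK (evD _ _)     l = l ≡ D
  LabelOK (evT₁ _ _)    l = ⊤
  LabelOK (evT₂ _ _)    l = ⊤

  module _ {m : ℕ} (σ : Fin m → Fin n) where

    data Rec : GTree m → Fin n → Set where
      leafR : ∀ {x a} → Seq a (σ x) → Rec (leaf x) a
      nodeR : ∀ {g h a c b₁ b₂} → Seq a c → LastEv c b₁ b₂ → Rec g b₁ → Rec h b₂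
            → Rec (node g h) a

    recTransfers : ∀ {G a} → Rec G a → ℕ
    recTransfers (leafR s)          = seqTransfers s
    recTransfers (nodeR s e r₁ r₂)  =
      seqTransfers s + lastTransfers e + recTransfers r₁ + recTransfers r₂

    Reconciliation : GTree m → Set
    Reconciliation G = Σ (Fin n) (Rec G)

    transfers : ∀ {G} → Reconciliation G → ℕ
    transfers (a , r) = recTransfers r

    -- Agree r L : L is G with internal nodes labelled by the relabelling e*
    -- (S for S, D for D, TS ↦ S or TD ↦ D for T)
    data Agree : ∀ {G a} → Rec G a → BDS m → Set where
      leafA : ∀ {x a} {s : Seq a (σ x)} → Agree (leafR s) (leaf x)
      nodeA : ∀ {g h a c b₁ b₂} {s : Seq a c} {e : LastEv c b₁ b₂}
                {r₁ : Rec g b₁} {r₂ : Rec h b₂} {l L₁ L₂}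
            → LabelOK e l → Agree r₁ L₁ → Agree r₂ L₂ → Agree (nodeR s e r₁ r₂) (node l L₁ L₂)

    Displays : ∀ {G} → Reconciliation G → (Fin m → Fin m → Bool) → Set
    Displays (a , r) E = ∃ λ L → Agree r L × GraphIs (toDS L) E

    ConsistentUsing : (Fin m → Fin m → Bool) → ℕ → Set
    ConsistentUsing E k =
      ∃ λ (G : GTree m) → GeneTreeOn G ×
        ∃ λ (α : Reconciliation G) → transfers α ≡ k × Displays α E

    Consistent : (Fin m → Fin m → Bool) → Set
    Consistent E = ∃ λ k → ConsistentUsing E k

    ReconcilableUsing : BDS m → ℕ → Set
    ReconcilableUsing D′ k =
      ∃ λ (α : Reconciliation (shape D′)) → transfers α ≡ k × Agree (proj₂ α) D′

    Reconcilable : BDS m → Set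
    Reconcilable D′ = ∃ λ k → ReconcilableUsing D′ k

-- A reconciliation displaying R turns the gene tree into a binary DS-tree D′
-- (label T-events as TS or TD as the display prescribes) with R(D′) = R, and
-- conversely a reconciled binary DS-tree is such a labelled gene tree.  The
-- least-resolved D is obtained from D′ by contracting every arc between equally
-- labelled internal nodes; a contraction keeps the leaf set, and the lowest
-- common ancestor of two leaves either survives or is merged into a parent
-- carrying the same label, so R(D) = R(D′).

module Submission where

open import Defs
open import Data.Nat using (ℕ; _≤_; s≤s; z≤n)
open import Data.Fin using (Fin; zero; suc)
open import Data.Fin.Properties using (suc-injective)
open import Data.Bool using (Bool; false)
open import Data.Empty using (⊥-elim)
open import Data.Maybe using (just)
open import Data.Maybe.Properties using (just-injective)
open import Data.Product using (∃; _×_; _,_; map₂)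
open import Data.Sum using (_⊎_; inj₁; inj₂; [_,_]′)
import Data.Sum as Sum
open import Data.List using (List; []; _∷_; _++_; length; lookup; allFin)
open import Data.List.Properties using (++-assoc; ++-identityʳ)
open import Data.List.Membership.Propositional using (_∈_; lose; find)
open import Data.List.Membership.Propositional.Properties using (∈-++⁺ˡ; ∈-++⁺ʳ; ∈-++⁻)
open import Data.List.Relation.Unary.Any as Any using (Any; here; there)
import Data.List.Relation.Unary.Any.Properties as Anyₚ
open import Data.List.Relation.Unary.All using (All; []; _∷_)
import Data.List.Relation.Unary.All.Properties as Allₚ
open import Data.List.Relation.Binary.Permutation.Propositional using (_↭_)
open import Relation.Binary.Definitions using (DecidableEquality)
open import Relation.Binary.PropositionalEquality
open import Relation.Nullary using (yes; no)
open import Function.Bundles using (_⇔_; mk⇔; Equivalence)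
import Function.Properties.Equivalence as ⇔

dleavesL-++ : ∀ {m} (ts us : List (DSTree m)) → dleavesL (ts ++ us) ≡ dleavesL ts ++ dleavesL us
dleavesL-++ []       us = refl
dleavesL-++ (t ∷ ts) us = begin
  dleaves t ++ dleavesL (ts ++ us)          ≡⟨ cong (dleaves t ++_) (dleavesL-++ ts us) ⟩
  dleaves t ++ dleavesL ts ++ dleavesL us   ≡⟨ ++-assoc (dleaves t) (dleavesL ts) (dleavesL us) ⟨
  (dleaves t ++ dleavesL ts) ++ dleavesL us ∎
  where open ≡-Reasoning

module _ {m} {z : Fin m} where

  ∈-dleavesL-++⁺ˡ : ∀ ts {us : List (DSTree m)} → z ∈ dleavesL ts → z ∈ dleavesL (ts ++ us)
  ∈-dleavesL-++⁺ˡ ts {us} p = subst (z ∈_) (sym (dleavesL-++ ts us)) (∈-++⁺ˡ p)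

  ∈-dleavesL-++⁺ʳ : ∀ ts {us : List (DSTree m)} → z ∈ dleavesL us → z ∈ dleavesL (ts ++ us)
  ∈-dleavesL-++⁺ʳ ts {us} p = subst (z ∈_) (sym (dleavesL-++ ts us)) (∈-++⁺ʳ (dleavesL ts) p)

  ∈-dleavesL-++⁻ : ∀ ts {us : List (DSTree m)} → z ∈ dleavesL (ts ++ us)
                 → z ∈ dleavesL ts ⊎ z ∈ dleavesL us
  ∈-dleavesL-++⁻ ts {us} p = ∈-++⁻ (dleavesL ts) (subst (z ∈_) (dleavesL-++ ts us) p)

  ∈-dleavesL⁺ : ∀ (ts : List (DSTree m)) i → z ∈ dleaves (lookup ts i) → z ∈ dleavesL ts
  ∈-dleavesL⁺ (t ∷ ts) zero    p = ∈-++⁺ˡ p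
  ∈-dleavesL⁺ (t ∷ ts) (suc i) p = ∈-++⁺ʳ (dleaves t) (∈-dleavesL⁺ ts i p)

  ∈-dleavesL⁻ : ∀ (ts : List (DSTree m)) → z ∈ dleavesL ts → ∃ λ i → z ∈ dleaves (lookup ts i)
  ∈-dleavesL⁻ (t ∷ ts) p with ∈-++⁻ (dleaves t) p
  ... | inj₁ p′ = zero , p′
  ... | inj₂ p′ = let i , q = ∈-dleavesL⁻ ts p′ in suc i , q

mutual
  Contract-dleaves : ∀ {m} {t u : DSTree m} → Contract t u → dleaves t ≡ dleaves u
  Contract-dleaves leafC      = refl
  Contract-dleaves (nodeC cs) = ContractL-dleavesL cs

  ContractL-dleavesL : ∀ {m l} {ts us : List (DSTree m)} → ContractL l ts us → dleavesL ts ≡ dleavesL us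
  ContractL-dleavesL nilC        = refl
  ContractL-dleavesL (keep c cs) = cong₂ _++_ (Contract-dleaves c) (ContractL-dleavesL cs)
  ContractL-dleavesL (merge {ws = ws} {us = us} cv cs) =
    trans (cong₂ _++_ (ContractL-dleavesL cv) (ContractL-dleavesL cs)) (sym (dleavesL-++ ws us))

data Before {m} (x y : Fin m) : List (DSTree m) → Set where
  now   : ∀ {t ts} → x ∈ dleaves t → y ∈ dleavesL ts → Before x y (t ∷ ts)
  later : ∀ {t ts} → Before x y ts → Before x y (t ∷ ts)

Separated : ∀ {m} → Fin m → Fin m → List (DSTree m) → Set
Separated x y ts = Before x y ts ⊎ Before y x ts

module _ {m} {x y : Fin m} where

  Before-++⁺ˡ : ∀ {ts} us → Before x y ts → Before x y (ts ++ us)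
  Before-++⁺ˡ us (now {ts = ts} p q) = now p (∈-dleavesL-++⁺ˡ ts q)
  Before-++⁺ˡ us (later b)           = later (Before-++⁺ˡ us b)

  Before-++⁺ʳ : ∀ ts {us} → Before x y us → Before x y (ts ++ us)
  Before-++⁺ʳ []       b = b
  Before-++⁺ʳ (t ∷ ts) b = later (Before-++⁺ʳ ts b)

  Before-++-across : ∀ ts {us} → x ∈ dleavesL ts → y ∈ dleavesL us → Before x y (ts ++ us)
  Before-++-across (t ∷ ts) p q with ∈-++⁻ (dleaves t) p
  ... | inj₁ p′ = now p′ (∈-dleavesL-++⁺ʳ ts q)
  ... | inj₂ p′ = later (Before-++-across ts p′ q)

  Before-++⁻ : ∀ ts {us} → Before x y (ts ++ us)
             → Before x y ts ⊎ Before x y us ⊎ (x ∈ dleavesL ts × y ∈ dleavesL us)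
  Before-++⁻ []       b = inj₂ (inj₁ b)
  Before-++⁻ (t ∷ ts) (now p q) with ∈-dleavesL-++⁻ ts q
  ... | inj₁ q′ = inj₁ (now p q′)
  ... | inj₂ q′ = inj₂ (inj₂ (∈-++⁺ˡ p , q′))
  Before-++⁻ (t ∷ ts) (later b) with Before-++⁻ ts b
  ... | inj₁ b′              = inj₁ (later b′)
  ... | inj₂ (inj₁ b′)       = inj₂ (inj₁ b′)
  ... | inj₂ (inj₂ (p , q))  = inj₂ (inj₂ (∈-++⁺ʳ (dleaves t) p , q))

  Before⇒indices : ∀ {ts} → Before x y ts
                 → ∃ λ i → ∃ λ j → i ≢ j × x ∈ dleaves (lookup ts i) × y ∈ dleaves (lookup ts j)
  Before⇒indices {t ∷ ts} (now p q) with ∈-dleavesL⁻ ts q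
  ... | j , q′ = zero , suc j , (λ ()) , p , q′
  Before⇒indices (later b) with Before⇒indices b
  ... | i , j , i≢j , p , q = suc i , suc j , (λ e → i≢j (suc-injective e)) , p , q

Separated⇒LcaLab : ∀ {m} {x y : Fin m} {l ts} → Separated x y ts → LcaLab (node l ts) x y l
Separated⇒LcaLab (inj₁ b) with Before⇒indices b
... | i , j , i≢j , p , q = here i j i≢j p q
Separated⇒LcaLab (inj₂ b) with Before⇒indices b
... | j , i , j≢i , q , p = here i j (≢-sym j≢i) p q

indices⇒Separated : ∀ {m} {x y : Fin m} ts (i j : Fin (length ts)) → i ≢ j
                  → x ∈ dleaves (lookup ts i) → y ∈ dleaves (lookup ts j) → Separated x y ts
indices⇒Separated (t ∷ ts) zero    zero    i≢j _ _ = ⊥-elim (i≢j refl)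
indices⇒Separated (t ∷ ts) zero    (suc j) _   p q = inj₁ (now p (∈-dleavesL⁺ ts j q))
indices⇒Separated (t ∷ ts) (suc i) zero    _   p q = inj₂ (now q (∈-dleavesL⁺ ts i p))
indices⇒Separated (t ∷ ts) (suc i) (suc j) i≢j p q =
  Sum.map later later (indices⇒Separated ts i j (λ e → i≢j (cong suc e)) p q)

LcaLab-sym : ∀ {m} {t : DSTree m} {x y l} → LcaLab t x y l → LcaLab t y x l
LcaLab-sym (here i j i≢j p q) = here j i (≢-sym i≢j) q p
LcaLab-sym (there t∈ lt)      = there t∈ (LcaLab-sym lt)

Any⇒LcaLab : ∀ {m l l′ x y} {ts : List (DSTree m)} → Any (λ t → LcaLab t x y l′) ts → LcaLab (node l ts) x y l′
Any⇒LcaLab a with find a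
... | t , t∈ , lt = there t∈ lt

module _ {m} {x y : Fin m} where

  Before-contract : ∀ {l ts us} → ContractL l ts us → Before x y ts → Before x y us
  Before-contract (keep c cs) (now p q) =
    now (subst (x ∈_) (Contract-dleaves c) p) (subst (y ∈_) (ContractL-dleavesL cs) q)
  Before-contract (keep c cs) (later b) = later (Before-contract cs b)
  Before-contract (merge {ws = ws} cv cs) (now p q) =
    Before-++-across ws (subst (x ∈_) (ContractL-dleavesL cv) p) (subst (y ∈_) (ContractL-dleavesL cs) q)
  Before-contract (merge {ws = ws} cv cs) (later b) = Before-++⁺ʳ ws (Before-contract cs b)

  -- Undoing a merge, x and y either stay in different children or fall
  -- apart only inside the merged child, which then is their lca.
  Before-uncontract : ∀ {l ts us} → ContractL l ts us → Before x y us
                    → Before x y ts ⊎ Any (λ t → LcaLab t x y l) ts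
  Before-uncontract (keep c cs) (now p q) =
    inj₁ (now (subst (x ∈_) (sym (Contract-dleaves c)) p) (subst (y ∈_) (sym (ContractL-dleavesL cs)) q))
  Before-uncontract (keep c cs) (later b) = Sum.map later there (Before-uncontract cs b)
  Before-uncontract (merge {ws = ws} cv cs) b with Before-++⁻ ws b
  ... | inj₁ b′ = inj₂ (here ([ (λ b″ → Separated⇒LcaLab (inj₁ b″)) , Any⇒LcaLab ]′ (Before-uncontract cv b′)))
  ... | inj₂ (inj₁ b′) = Sum.map later there (Before-uncontract cs b′)
  ... | inj₂ (inj₂ (p , q)) =
    inj₁ (now (subst (x ∈_) (sym (ContractL-dleavesL cv)) p) (subst (y ∈_) (sym (ContractL-dleavesL cs)) q))

Separated-contract : ∀ {m} {x y : Fin m} {l ts us} → ContractL l ts us → Separated x y ts → Separated x y us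
Separated-contract cs = Sum.map (Before-contract cs) (Before-contract cs)

Separated-uncontract : ∀ {m} {x y : Fin m} {l ts us} → ContractL l ts us → Separated x y us
                     → Separated x y ts ⊎ Any (λ t → LcaLab t x y l) ts
Separated-uncontract cs (inj₁ b) = Sum.map₁ inj₁ (Before-uncontract cs b)
Separated-uncontract cs (inj₂ b) = Sum.map inj₂ (Any.map LcaLab-sym) (Before-uncontract cs b)

Separated-++⁺ˡ : ∀ {m} {x y : Fin m} {ts} us → Separated x y ts → Separated x y (ts ++ us)
Separated-++⁺ˡ us = Sum.map (Before-++⁺ˡ us) (Before-++⁺ˡ us)

Separated-++⁺ʳ : ∀ {m} {x y : Fin m} ts {us} → Separated x y us → Separated x y (ts ++ us)
Separated-++⁺ʳ ts = Sum.map (Before-++⁺ʳ ts) (Before-++⁺ʳ ts)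

module _ {m} {x y : Fin m} where

  mutual
    LcaLab-contract : ∀ {t u : DSTree m} {l} → Contract t u → LcaLab t x y l → LcaLab u x y l
    LcaLab-contract (nodeC cs) (here i j i≢j p q) =
      Separated⇒LcaLab (Separated-contract cs (indices⇒Separated _ i j i≢j p q))
    LcaLab-contract (nodeC cs) (there t∈ lt) with AnyLcaLab-contract cs (lose t∈ lt)
    ... | inj₁ (refl , s) = Separated⇒LcaLab s
    ... | inj₂ a          = Any⇒LcaLab a

    AnyLcaLab-contract : ∀ {l l′ ts us} → ContractL l ts us → Any (λ t → LcaLab t x y l′) ts
                       → (l′ ≡ l × Separated x y us) ⊎ Any (λ u → LcaLab u x y l′) us
    AnyLcaLab-contract (keep c cs) (here lt) = inj₂ (here (LcaLab-contract c lt))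
    AnyLcaLab-contract (keep c cs) (there a) =
      Sum.map (map₂ (Separated-++⁺ʳ (_ ∷ []))) there (AnyLcaLab-contract cs a)
    AnyLcaLab-contract (merge {vs = vs} {us = us} cv cs) (here (here i j i≢j p q)) =
      inj₁ (refl , Separated-++⁺ˡ us (Separated-contract cv (indices⇒Separated vs i j i≢j p q)))
    AnyLcaLab-contract (merge {us = us} cv cs) (here (there v∈ lv)) =
      Sum.map (map₂ (Separated-++⁺ˡ us)) Anyₚ.++⁺ˡ (AnyLcaLab-contract cv (lose v∈ lv))
    AnyLcaLab-contract (merge {ws = ws} cv cs) (there a) =
      Sum.map (map₂ (Separated-++⁺ʳ ws)) (Anyₚ.++⁺ʳ ws) (AnyLcaLab-contract cs a)

  mutual
    LcaLab-uncontract : ∀ {t u : DSTree m} {l} → Contract t u → LcaLab u x y l → LcaLab t x y l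
    LcaLab-uncontract (nodeC cs) (here i j i≢j p q) =
      [ Separated⇒LcaLab , Any⇒LcaLab ]′ (Separated-uncontract cs (indices⇒Separated _ i j i≢j p q))
    LcaLab-uncontract (nodeC cs) (there u∈ lu) = Any⇒LcaLab (AnyLcaLab-uncontract cs (lose u∈ lu))

    AnyLcaLab-uncontract : ∀ {l l′ ts us} → ContractL l ts us → Any (λ u → LcaLab u x y l′) us
                         → Any (λ t → LcaLab t x y l′) ts
    AnyLcaLab-uncontract (keep c cs) (here lu) = here (LcaLab-uncontract c lu)
    AnyLcaLab-uncontract (keep c cs) (there a) = there (AnyLcaLab-uncontract cs a)
    AnyLcaLab-uncontract (merge {ws = ws} cv cs) a =
      [ (λ b → here (Any⇒LcaLab (AnyLcaLab-uncontract cv b))) , (λ b → there (AnyLcaLab-uncontract cs b)) ]′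
        (Anyₚ.++⁻ ws a)

GraphIs-Contract⇔ : ∀ {m} {t u : DSTree m} {E} → Contract t u → GraphIs t E ⇔ GraphIs u E
GraphIs-Contract⇔ c = mk⇔
  (λ g x y x≢y → ⇔.trans (g x y x≢y) (mk⇔ (LcaLab-contract c) (LcaLab-uncontract c)))
  (λ g x y x≢y → ⇔.trans (g x y x≢y) (mk⇔ (LcaLab-uncontract c) (LcaLab-contract c)))

_≟ˡ_ : DecidableEquality Label
S ≟ˡ S = yes refl
S ≟ˡ D = no (λ ())
D ≟ˡ S = no (λ ())
D ≟ˡ D = yes refl

mutual
  -- The children that g contributes to a parent labelled l once every arc
  -- between equally labelled internal nodes is contracted.
  absorb : ∀ {m} → Label → BDS m → List (DSTree m)
  absorb l (leaf x) = leaf x ∷ []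
  absorb l (node l′ g h) with l ≟ˡ l′
  ... | yes _ = contractedChildren l g h
  ... | no _  = node l′ (contractedChildren l′ g h) ∷ []

  -- The trailing [] mirrors the two-element child list produced by toDS.
  contractedChildren : ∀ {m} → Label → BDS m → BDS m → List (DSTree m)
  contractedChildren l g h = absorb l g ++ absorb l h ++ []

contractAll : ∀ {m} → BDS m → DSTree m
contractAll (leaf x)     = leaf x
contractAll (node l g h) = node l (contractedChildren l g h)

mutual
  ContractL-absorb : ∀ {m} l (g : BDS m) {ts us} → ContractL l ts us
                   → ContractL l (toDS g ∷ ts) (absorb l g ++ us)
  ContractL-absorb l (leaf x) cs = keep leafC cs
  ContractL-absorb l (node l′ g h) cs with l ≟ˡ l′
  ... | yes refl = merge (ContractL-contractedChildren l g h) cs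
  ... | no _     = keep (nodeC (ContractL-contractedChildren l′ g h)) cs

  ContractL-contractedChildren : ∀ {m} l (g h : BDS m)
                               → ContractL l (toDS g ∷ toDS h ∷ []) (contractedChildren l g h)
  ContractL-contractedChildren l g h = ContractL-absorb l g (ContractL-absorb l h nilC)

Contract-contractAll : ∀ {m} (g : BDS m) → Contract (toDS g) (contractAll g)
Contract-contractAll (leaf x)     = leafC
Contract-contractAll (node l g h) = nodeC (ContractL-contractedChildren l g h)

module _ {A : Set} where

  1≤length-++ˡ : ∀ (xs : List A) {ys} → 1 ≤ length xs → 1 ≤ length (xs ++ ys)
  1≤length-++ˡ (_ ∷ _) _ = s≤s z≤n

  2≤length-++ : ∀ (xs : List A) {ys} → 1 ≤ length xs → 1 ≤ length ys → 2 ≤ length (xs ++ ys)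
  2≤length-++ (_ ∷ [])    _ ys≥1 = s≤s ys≥1
  2≤length-++ (_ ∷ _ ∷ _) _ _    = s≤s (s≤s z≤n)

1≤length-absorb : ∀ {m} l (g : BDS m) → 1 ≤ length (absorb l g)
1≤length-absorb l (leaf x) = s≤s z≤n
1≤length-absorb l (node l′ g h) with l ≟ˡ l′
... | yes _ = 1≤length-++ˡ (absorb l g) (1≤length-absorb l g)
... | no _  = s≤s z≤n

2≤length-contractedChildren : ∀ {m} l (g h : BDS m) → 2 ≤ length (contractedChildren l g h)
2≤length-contractedChildren l g h =
  2≤length-++ (absorb l g) (1≤length-absorb l g) (1≤length-++ˡ (absorb l h) (1≤length-absorb l h))

mutual
  All-WF-absorb : ∀ {m} l (g : BDS m) → All WF (absorb l g)
  All-WF-absorb l (leaf x) = leafWF ∷ []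
  All-WF-absorb l (node l′ g h) with l ≟ˡ l′
  ... | yes _ = All-WF-contractedChildren l g h
  ... | no _  = nodeWF (2≤length-contractedChildren l′ g h) (All-WF-contractedChildren l′ g h) ∷ []

  All-WF-contractedChildren : ∀ {m} l (g h : BDS m) → All WF (contractedChildren l g h)
  All-WF-contractedChildren l g h = Allₚ.++⁺ (All-WF-absorb l g) (Allₚ.++⁺ (All-WF-absorb l h) [])

WF-contractAll : ∀ {m} (g : BDS m) → WF (contractAll g)
WF-contractAll (leaf x)     = leafWF
WF-contractAll (node l g h) = nodeWF (2≤length-contractedChildren l g h) (All-WF-contractedChildren l g h)

mutual
  absorb-labels : ∀ {m} l (g : BDS m) → All (λ t → labelOf t ≢ just l) (absorb l g)
  absorb-labels l (leaf x) = (λ ()) ∷ []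
  absorb-labels l (node l′ g h) with l ≟ˡ l′
  ... | yes _   = contractedChildren-labels l g h
  ... | no l≢l′ = (λ e → l≢l′ (sym (just-injective e))) ∷ []

  contractedChildren-labels : ∀ {m} l (g h : BDS m) → All (λ t → labelOf t ≢ just l) (contractedChildren l g h)
  contractedChildren-labels l g h = Allₚ.++⁺ (absorb-labels l g) (Allₚ.++⁺ (absorb-labels l h) [])

mutual
  All-LeastResolved-absorb : ∀ {m} l (g : BDS m) → All LeastResolved (absorb l g)
  All-LeastResolved-absorb l (leaf x) = leafLR ∷ []
  All-LeastResolved-absorb l (node l′ g h) with l ≟ˡ l′
  ... | yes _ = All-LeastResolved-contractedChildren l g h
  ... | no _  = nodeLR (contractedChildren-labels l′ g h) (All-LeastResolved-contractedChildren l′ g h) ∷ []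

  All-LeastResolved-contractedChildren : ∀ {m} l (g h : BDS m) → All LeastResolved (contractedChildren l g h)
  All-LeastResolved-contractedChildren l g h =
    Allₚ.++⁺ (All-LeastResolved-absorb l g) (Allₚ.++⁺ (All-LeastResolved-absorb l h) [])

LeastResolved-contractAll : ∀ {m} (g : BDS m) → LeastResolved (contractAll g)
LeastResolved-contractAll (leaf x)     = leafLR
LeastResolved-contractAll (node l g h) =
  nodeLR (contractedChildren-labels l g h) (All-LeastResolved-contractedChildren l g h)

gleaves-shape : ∀ {m} (g : BDS m) → gleaves (shape g) ≡ dleaves (toDS g)
gleaves-shape (leaf x)     = refl
gleaves-shape (node l g h) = cong₂ _++_ (gleaves-shape g) (trans (gleaves-shape h) (sym (++-identityʳ _)))

gleaves-refinement : ∀ {m} {D′ : BDS m} {T} → BinaryRefinement D′ T → gleaves (shape D′) ≡ dleaves T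
gleaves-refinement {D′ = D′} c = trans (gleaves-shape D′) (Contract-dleaves c)

Agree-shape : ∀ {N : Network} {m} {σ : Fin m → Fin (nodes N)} {G a} {r : Rec N σ G a} {L}
            → Agree N σ r L → shape L ≡ G
Agree-shape leafA             = refl
Agree-shape (nodeA _ ag₁ ag₂) = cong₂ node (Agree-shape ag₁) (Agree-shape ag₂)

module _ (N : Network) {m} (σ : Fin m → Fin (nodes N)) (E : Fin m → Fin m → Bool) where

  LeastResolvedRefinement : (BDS m → Set) → Set
  LeastResolvedRefinement P =
    ∃ λ (T : DSTree m) → DSTreeOn T × LeastResolved T × GraphIs T E
      × ∃ λ (D′ : BDS m) → BinaryRefinement D′ T × P D′

  LeastResolvedRefinement-map : ∀ {P Q : BDS m → Set} → (∀ {D′} → P D′ → Q D′)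
                              → LeastResolvedRefinement P → LeastResolvedRefinement Q
  LeastResolvedRefinement-map f (T , on , lr , gi , D′ , c , p) = T , on , lr , gi , D′ , c , f p

  consistentUsing⇒refinement : ∀ {k} → ConsistentUsing N σ E k
                             → LeastResolvedRefinement (λ D′ → ReconcilableUsing N σ D′ k)
  consistentUsing⇒refinement (G , G-on , (a , r) , r-k , L , ag , gi) with Agree-shape ag
  ... | refl = contractAll L
             , (WF-contractAll L , subst (_↭ allFin m) (gleaves-refinement (Contract-contractAll L)) G-on)
             , LeastResolved-contractAll L
             , Equivalence.to (GraphIs-Contract⇔ (Contract-contractAll L)) gi
             , L , Contract-contractAll L , (a , r) , r-k , ag

  refinement⇒consistentUsing : ∀ {k} → LeastResolvedRefinement (λ D′ → ReconcilableUsing N σ D′ k)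
                             → ConsistentUsing N σ E k
  refinement⇒consistentUsing (T , (_ , T-on) , _ , gi , D′ , c , α , α-k , ag) =
    shape D′ , subst (_↭ allFin m) (sym (gleaves-refinement c)) T-on ,
    α , α-k , D′ , ag , Equivalence.from (GraphIs-Contract⇔ c) gi

  consistentUsing⇔refinement : ∀ k → ConsistentUsing N σ E k
                             ⇔ LeastResolvedRefinement (λ D′ → ReconcilableUsing N σ D′ k)
  consistentUsing⇔refinement k = mk⇔ consistentUsing⇒refinement refinement⇒consistentUsing

  consistent⇔refinement : Consistent N σ E ⇔ LeastResolvedRefinement (Reconcilable N σ)
  consistent⇔refinement = mk⇔
    (λ (k , c) → LeastResolvedRefinement-map (k ,_) (consistentUsing⇒refinement c))
    (λ (T , on , lr , gi , D′ , c , k , rec) → k , refinement⇒consistentUsing (T , on , lr , gi , D′ , c , rec))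

mainTheorem1 : (N : Network) (m : ℕ) (σ : Fin m → Fin (nodes N))
    → (∀ x → IsLeaf N (σ x))
    → (E : Fin m → Fin m → Bool)
    → (∀ x y → E x y ≡ E y x)
    → (∀ x → E x x ≡ false)
    → (∀ (k : ℕ) → ConsistentUsing N σ E k
         ⇔ (∃ λ (T : DSTree m) → DSTreeOn T × LeastResolved T × GraphIs T E
              × ∃ λ (D′ : BDS m) → BinaryRefinement D′ T × ReconcilableUsing N σ D′ k))
      × (Consistent N σ E
         ⇔ (∃ λ (T : DSTree m) → DSTreeOn T × LeastResolved T × GraphIs T E
              × ∃ λ (D′ : BDS m) → BinaryRefinement D′ T × Reconcilable N σ D′))
mainTheorem1 N m σ _ E _ _ = consistentUsing⇔refinement N σ E , consistent⇔refinement N σ E
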